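{- Let $\chi_{\mathrm{OPT}}$ and $\chi_{\mathrm{OFF}}$ be two red/blue colorings of the nodes of the $n$-node cycle ($n$ even) with cut-edge sets $\mathcal{C}_{\mathrm{OPT}}$ and $\mathcal{C}_{\mathrm{OFF}}$ satisfying $\mathcal{C}_{\mathrm{OFF}}\subseteq\mathcal{C}_{\mathrm{OPT}}$, and suppose $\chi_{\mathrm{OPT}}$ is $1$-balanced (exactly $n/2$ nodes of each color). Then $\textsc{less}(\mathcal{C}_{\mathrm{OFF}})+|\Phi|\ge n/2$.
   Context: Cycle on nodes $v_1,\dots,v_n$ with edges $(v_1,v_2),\dots,(v_n,v_1)$ and a fixed clockwise orientation. Cut-edges of a coloring are cycle edges whose endpoints have different colors. For a valid (even-size) set $\mathcal{C}$ of cut-edges, $\textsc{less}(\mathcal{C})$ is the number of nodes having the less frequent color in the coloring induced by $\mathcal{C}$ (i.e., the minimum of the two color-class sizes). For cycle edges $c_i,c_j$, $A^\circ(c_i,c_j)$ is the set of nodes encountered moving clockwise from $c_i$ to $c_j$. Definition of $\Phi$: if $\mathcal{C}_{\mathrm{OPT}}=\mathcal{C}_{\mathrm{OFF}}$ then $\Phi=\emptyset$; otherwise let $c_1,\dots,c_m$ be the edges of $\mathcal{C}_{\mathrm{OPT}}\setminus\mathcal{C}_{\mathrm{OFF}}$ in clockwise order, $\Phi_0=A^\circ(c_1,c_2)\uplus A^\circ(c_3,c_4)\uplus\dots\uplus A^\circ(c_{m-1},c_m)$, $\Phi_1=A^\circ(c_m,c_1)\uplus A^\circ(c_2,c_3)\uplus\dots\uplus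 A^\circ(c_{m-2},c_{m-1})$, and $\Phi$ is the smaller of $\Phi_0,\Phi_1$. -}

module Defs where

open import Data.Nat using (ℕ; zero; suc; _+_; _∸_; _<_; _≤_; _<ᵇ_; _≤ᵇ_; _⊓_)
open import Data.Nat.DivMod using (_%_; m%n<n)
open import Data.Fin using (Fin; toℕ; fromℕ<)
open import Data.Bool using (Bool; true; false; not; _∧_; _∨_; _xor_; if_then_else_)
open import Data.List using (List; []; _∷_; _++_; [_]; map; filter; sum; length)
open import Data.List.Base using (allFin)
open import Relation.Nullary.Decidable using (Dec)
open import Relation.Binary.PropositionalEquality using (_≡_)
open import Data.Bool.Properties using (T?)
open import Data.Bool using (T)

-- Cycle on nodes v_0,…,v_{n-1} (0-indexed); edge i is (v_i , v_{i+1 mod n}).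
-- Clockwise = increasing index (mod n).

Coloring : ℕ → Set
Coloring n = Fin n → Bool      -- true = red, false = blue

EdgeSet : ℕ → Set
EdgeSet n = Fin n → Bool

next : ∀ {n} → Fin n → Fin n
next {suc m} i = fromℕ< (m%n<n (suc (toℕ i)) (suc m))

count : ∀ {n} → (Fin n → Bool) → ℕ
count {n} p = length (filter (λ i → T? (p i)) (allFin n))

cutEdges : ∀ {n} → Coloring n → EdgeSet n
cutEdges χ i = χ i xor χ (next i)

-- coloring induced by a (valid, even-size) set of cut-edges:
-- v_0 gets false; crossing an edge of C flips the color.
parity : List Bool → Bool
parity []       = false
parity (b ∷ bs) = b xor parity bs

induced : ∀ {n} → EdgeSet n → Coloring n
induced {n} C v = parity (map C (filter (λ j → toℕ j <? toℕ v) (allFin n)))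
  where open import Data.Nat using (_<?_)

less : ∀ {n} → EdgeSet n → ℕ
less C = count (induced C) ⊓ count (λ v → not (induced C v))

-- A°(c_a, c_b), edges given by their indices a b (edge a = (v_a, v_{a+1})):
-- the nodes encountered moving clockwise from edge a to edge b,
-- i.e. v_{a+1}, v_{a+2}, …, v_b (indices mod n).
inArc : ∀ {n} → ℕ → ℕ → Fin n → Bool
inArc a b v = if a <ᵇ b then (a <ᵇ toℕ v) ∧ (toℕ v ≤ᵇ b)
                        else (a <ᵇ toℕ v) ∨ (toℕ v ≤ᵇ b)

arcSize : ℕ → ℕ → ℕ → ℕ
arcSize n a b = count {n} (inArc a b)

pairSizes : ℕ → List ℕ → ℕ
pairSizes n (a ∷ b ∷ rest) = arcSize n a b + pairSizes n rest
pairSizes n _              = 0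

-- edges of C_OPT \ C_OFF, listed in clockwise order (starting from edge 0)
diffEdges : ∀ {n} → EdgeSet n → EdgeSet n → List ℕ
diffEdges {n} Copt Coff =
  map toℕ (filter (λ e → T? (Copt e ∧ not (Coff e))) (allFin n))

-- |Φ_0| = |A°(c_1,c_2) ⊎ A°(c_3,c_4) ⊎ … ⊎ A°(c_{m-1},c_m)|
Φ₀size : ∀ {n} → EdgeSet n → EdgeSet n → ℕ
Φ₀size {n} Copt Coff = pairSizes n (diffEdges Copt Coff)

-- |Φ_1| = |A°(c_m,c_1) ⊎ A°(c_2,c_3) ⊎ … ⊎ A°(c_{m-2},c_{m-1})|
Φ₁size : ∀ {n} → EdgeSet n → EdgeSet n → ℕ
Φ₁size {n} Copt Coff with diffEdges Copt Coff
... | []       = 0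
... | c₁ ∷ cs  = pairSizes n (cs ++ [ c₁ ])

Φsize : ∀ {n} → EdgeSet n → EdgeSet n → ℕ
Φsize Copt Coff with diffEdges Copt Coff
... | []      = 0
... | _ ∷ _   = Φ₀size Copt Coff ⊓ Φ₁size Copt Coff

-- Write ψ = χOPT ⊕ χOFF, so that χOPT = ψ ⊕ χOFF. The size of the smaller color class is
-- subadditive under ⊕, since each class of χ ⊕ φ is covered by a class of χ and a class of φ;
-- hence k = minority χOPT ≤ minority χOFF + minority ψ. The coloring induced by C_OFF is χOFF up
-- to a global flip, so minority χOFF = less(C_OFF). As C_OFF ⊆ C_OPT, the cut edges of ψ are
-- exactly C_OPT ∖ C_OFF = {c₁ < … < c_m}, m is even as on any cycle, and ψ v differs from ψ v₀
-- iff an odd number of the cᵢ precede v. Those nodes lie in Φ₀ and all others in Φ₁, so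
-- minority ψ ≤ |Φ|.
module Submission where

open import Defs
open import Data.Nat using (ℕ; _*_; _+_; _≥_)
open import Data.Fin using (Fin)
open import Data.Bool using (Bool; true; not)
open import Relation.Binary.PropositionalEquality using (_≡_)

open import Data.Bool using (false; _∧_; _∨_; _xor_; if_then_else_; T)
open import Data.Bool.Properties
  using (T?; T-≡; T-∧; T-∨; not-involutive; xor-same; xor-identityʳ; ∧-comm; ∧-identityʳ)
open import Data.Bool.Solver using (module xor-∧-Solver)
open import Data.Empty using (⊥-elim)
open import Data.Fin using (toℕ; fromℕ<) renaming (zero to fzero)
open import Data.Fin.Properties using (toℕ-fromℕ<; toℕ-injective; toℕ<n)
open import Data.List using (List; []; _∷_; _++_; [_]; map; filter; filterᵇ; length; tabulate; allFin)
open import Data.List.Properties using (map-cong; map-∘; map-tabulate; tabulate-cong; filter-≐)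
open import Data.List.Relation.Unary.All as All using (All; []; _∷_)
open import Data.List.Relation.Unary.AllPairs using (AllPairs; []; _∷_)
import Data.List.Relation.Unary.AllPairs.Properties as AllPairs
open import Data.Nat using (zero; suc; _<_; _≤_; _<ᵇ_; _≤ᵇ_; _⊓_; z≤n; s≤s; _<?_)
open import Data.Nat.DivMod using (m%n<n; m<n⇒m%n≡m; n%n≡0)
open import Data.Nat.Properties
  using ( ≤-refl; ≤-reflexive; ≤-trans; <⇒≤; <-asym; ≮⇒≥; <⇒≱
        ; <ᵇ-reflects-<; <ᵇ⇒<; ≤ᵇ⇒≤; <⇒<ᵇ; ≤⇒≤ᵇ
        ; +-comm; +-mono-≤; +-monoʳ-≤; +-identityʳ
        ; ⊓-idem; ⊓-comm; ⊓-sel; ⊓-mono-≤; m⊓n≤m; m⊓n≤n; m≤n⇒m⊓n≡m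
        ; +-commutativeSemigroup; module ≤-Reasoning)
open import Algebra.Properties.CommutativeSemigroup +-commutativeSemigroup using (interchange)
open import Data.Product using (_×_; _,_; ∃; uncurry)
open import Data.Sum as Sum using (_⊎_; inj₁; inj₂)
open import Function using (_∘_; id)
open import Function.Bundles using (Equivalence)
open import Relation.Binary.PropositionalEquality
  using (refl; sym; trans; cong; cong₂; subst; _≗_; module ≡-Reasoning)
open import Relation.Nullary using (does)
open import Relation.Nullary.Reflects using (ofʸ; ofⁿ)
open import Relation.Unary using (Decidable)

open Equivalence using (to; from)

module _ where
  open xor-∧-Solver using (solve; _:+_; _:=_)

  xor-interchange : ∀ a b c d → (a xor b) xor (c xor d) ≡ (a xor c) xor (b xor d)
  xor-interchange = solve 4 (λ a b c d → (a :+ b) :+ (c :+ d) := (a :+ c) :+ (b :+ d)) refl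

  xor-telescope : ∀ a b c → (a xor b) xor (b xor c) ≡ a xor c
  xor-telescope = solve 3 (λ a b c → (a :+ b) :+ (b :+ c) := a :+ c) refl

  xor-cancelʳ : ∀ a b → (a xor b) xor b ≡ a
  xor-cancelʳ = solve 2 (λ a b → (a :+ b) :+ b := a) refl

T-xor⇒T⊎T : ∀ x y → T (x xor y) → T x ⊎ T y
T-xor⇒T⊎T true  _     _ = inj₁ _
T-xor⇒T⊎T false true  _ = inj₂ _
T-xor⇒T⊎T false false ()

∧-not≡xor : ∀ x y → (y ≡ true → x ≡ true) → x ∧ not y ≡ x xor y
∧-not≡xor true  true  _ = refl
∧-not≡xor true  false _ = refl
∧-not≡xor false false _ = refl
∧-not≡xor false true  y⇒x with y⇒x refl
... | ()

parity-map-filter : ∀ {A : Set} {P : A → Set} (P? : Decidable P) (q : A → Bool) xs →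
                    parity (map q (filter P? xs)) ≡ parity (map (λ x → does (P? x) ∧ q x) xs)
parity-map-filter P? q []       = refl
parity-map-filter P? q (x ∷ xs) with does (P? x)
... | true  = cong (q x xor_) (parity-map-filter P? q xs)
... | false = parity-map-filter P? q xs

module _ {A : Set} where
  private
    𝟙 : Bool → ℕ
    𝟙 b = if b then 1 else 0

    length-filterᵇ-∷ : ∀ (p : A → Bool) x xs →
                       length (filterᵇ p (x ∷ xs)) ≡ 𝟙 (p x) + length (filterᵇ p xs)
    length-filterᵇ-∷ p x xs with p x
    ... | true  = refl
    ... | false = refl

    𝟙-cover : ∀ {a b c} → (T a → T b ⊎ T c) → 𝟙 a ≤ 𝟙 b + 𝟙 c
    𝟙-cover {false}                 _ = z≤n
    𝟙-cover {true}  {true}          _ = s≤s z≤n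
    𝟙-cover {true}  {false} {true}  _ = s≤s z≤n
    𝟙-cover {true}  {false} {false} h = ⊥-elim (Sum.reduce (h _))

  length-filterᵇ-cover : ∀ {p q r : A → Bool} → (∀ x → T (p x) → T (q x) ⊎ T (r x)) → ∀ xs →
                         length (filterᵇ p xs) ≤ length (filterᵇ q xs) + length (filterᵇ r xs)
  length-filterᵇ-cover h [] = z≤n
  length-filterᵇ-cover {p} {q} {r} h (x ∷ xs) = begin
    length (filterᵇ p (x ∷ xs))     ≡⟨ length-filterᵇ-∷ p x xs ⟩
    𝟙 (p x) + length (filterᵇ p xs) ≤⟨ +-mono-≤ (𝟙-cover (h x)) (length-filterᵇ-cover h xs) ⟩
    (𝟙 (q x) + 𝟙 (r x)) + (Q + R)   ≡⟨ interchange (𝟙 (q x)) (𝟙 (r x)) Q R ⟩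
    (𝟙 (q x) + Q) + (𝟙 (r x) + R)   ≡⟨ cong₂ _+_ (length-filterᵇ-∷ q x xs) (length-filterᵇ-∷ r x xs) ⟨
    length (filterᵇ q (x ∷ xs)) + length (filterᵇ r (x ∷ xs)) ∎
    where
      open ≤-Reasoning
      Q = length (filterᵇ q xs)
      R = length (filterᵇ r xs)

  length-filterᵇ-false : ∀ xs → length (filterᵇ (λ (_ : A) → false) xs) ≡ 0
  length-filterᵇ-false []       = refl
  length-filterᵇ-false (_ ∷ xs) = length-filterᵇ-false xs

  filterᵇ-cong : ∀ {p q : A → Bool} → p ≗ q → filterᵇ p ≗ filterᵇ q
  filterᵇ-cong {p} {q} p≗q =
    filter-≐ (T? ∘ p) (T? ∘ q) ((λ {x} → subst T (p≗q x)) , (λ {x} → subst T (sym (p≗q x))))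

module _ {n : ℕ} where

  count-cover : ∀ {p q r : Fin n → Bool} → (∀ v → T (p v) → T (q v) ⊎ T (r v)) →
                count p ≤ count q + count r
  count-cover h = length-filterᵇ-cover h (allFin n)

  count-false : count {n} (λ _ → false) ≡ 0
  count-false = length-filterᵇ-false (allFin n)

  count-mono : ∀ {p q : Fin n → Bool} → (∀ v → T (p v) → T (q v)) → count p ≤ count q
  count-mono {p} {q} h = begin
    count p                          ≤⟨ count-cover {r = λ _ → false} (λ v → inj₁ ∘ h v) ⟩
    count q + count {n} (λ _ → false) ≡⟨ cong (count q +_) count-false ⟩
    count q + 0                      ≡⟨ +-identityʳ (count q) ⟩
    count q                          ∎
    where open ≤-Reasoning

  count-cong : ∀ {p q : Fin n → Bool} → p ≗ q → count p ≡ count q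
  count-cong p≗q = cong length (filterᵇ-cong p≗q (allFin n))

  count-xor : ∀ (p q : Fin n → Bool) → count (λ v → p v xor q v) ≤ count p + count q
  count-xor p q = count-cover (λ v → T-xor⇒T⊎T (p v) (q v))

minority : ∀ {n} → Coloring n → ℕ
minority χ = count χ ⊓ count (λ v → not (χ v))

infixl 6 _⊕_
_⊕_ : ∀ {n} → Coloring n → Coloring n → Coloring n
(χ ⊕ φ) v = χ v xor φ v

module _ {n : ℕ} where

  minority-cong : ∀ {χ φ : Coloring n} → χ ≗ φ → minority χ ≡ minority φ
  minority-cong χ≗φ = cong₂ _⊓_ (count-cong χ≗φ) (count-cong (cong not ∘ χ≗φ))

  minority-flip : ∀ c (χ : Coloring n) → minority (λ v → c xor χ v) ≡ minority χ
  minority-flip false χ = refl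
  minority-flip true  χ =
    trans (cong (count (λ v → not (χ v)) ⊓_) (count-cong (not-involutive ∘ χ)))
          (⊓-comm (count (λ v → not (χ v))) (count χ))

  minority≤count : ∀ c (χ : Coloring n) → minority χ ≤ count (λ v → c xor χ v)
  minority≤count false χ = m⊓n≤m _ _
  minority≤count true  χ = m⊓n≤n _ _

  minority-attained : ∀ (χ : Coloring n) → ∃ λ c → minority χ ≡ count (λ v → c xor χ v)
  minority-attained χ with ⊓-sel (count χ) (count (λ v → not (χ v)))
  ... | inj₁ eq = false , eq
  ... | inj₂ eq = true  , eq

  minority-⊕ : ∀ (χ φ : Coloring n) → minority (χ ⊕ φ) ≤ minority χ + minority φ
  minority-⊕ χ φ with minority-attained χ | minority-attained φ
  ... | b , χ-min | c , φ-min = begin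
    minority (χ ⊕ φ)                                  ≤⟨ minority≤count (b xor c) (χ ⊕ φ) ⟩
    count (λ v → (b xor c) xor (χ v xor φ v))         ≡⟨ count-cong (λ v → xor-interchange b c (χ v) (φ v)) ⟩
    count (λ v → (b xor χ v) xor (c xor φ v))         ≤⟨ count-xor (λ v → b xor χ v) (λ v → c xor φ v) ⟩
    count (λ v → b xor χ v) + count (λ v → c xor φ v) ≡⟨ sym (cong₂ _+_ χ-min φ-min) ⟩
    minority χ + minority φ                           ∎
    where open ≤-Reasoning

parity-telescope : ∀ N (f : ℕ → Bool) w →
                   parity (tabulate {n = N} (λ i → (toℕ i <ᵇ w) ∧ (f (toℕ i) xor f (suc (toℕ i)))))
                   ≡ f 0 xor f (w ⊓ N)
parity-telescope zero    f zero    = sym (xor-same (f 0))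
parity-telescope zero    f (suc w) = sym (xor-same (f 0))
parity-telescope (suc N) f zero    =
  trans (parity-telescope N (f ∘ suc) zero) (trans (xor-same (f 1)) (sym (xor-same (f 0))))
parity-telescope (suc N) f (suc w) =
  trans (cong ((f 0 xor f 1) xor_) (parity-telescope N (f ∘ suc) w))
        (xor-telescope (f 0) (f 1) (f (suc (w ⊓ N))))

module _ {m : ℕ} (χ : Coloring (suc m)) where

  -- The color of node i mod n; χ (next j) is colorAt (suc (toℕ j)) by definition.
  colorAt : ℕ → Bool
  colorAt i = χ (fromℕ< (m%n<n i (suc m)))

  colorAt-toℕ : ∀ v → colorAt (toℕ v) ≡ χ v
  colorAt-toℕ v = cong χ (toℕ-injective (trans (toℕ-fromℕ< _) (m<n⇒m%n≡m (toℕ<n v))))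

  colorAt-period : colorAt (suc m) ≡ χ fzero
  colorAt-period = cong χ (toℕ-injective (trans (toℕ-fromℕ< _) (n%n≡0 (suc m))))

  parity-cutEdges-below : ∀ w → w ≤ suc m →
    parity (map (λ j → (toℕ j <ᵇ w) ∧ cutEdges χ j) (allFin (suc m))) ≡ χ fzero xor colorAt w
  parity-cutEdges-below w w≤n = begin
    parity (map (λ j → (toℕ j <ᵇ w) ∧ cutEdges χ j) (allFin (suc m)))
      ≡⟨ cong parity (map-tabulate id (λ j → (toℕ j <ᵇ w) ∧ cutEdges χ j)) ⟩
    parity (tabulate {n = suc m} (λ j → (toℕ j <ᵇ w) ∧ cutEdges χ j))
      ≡⟨ cong parity (tabulate-cong (λ j →
           cong (λ b → (toℕ j <ᵇ w) ∧ (b xor colorAt (suc (toℕ j)))) (sym (colorAt-toℕ j)))) ⟩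
    parity (tabulate {n = suc m} (λ j → (toℕ j <ᵇ w) ∧ (colorAt (toℕ j) xor colorAt (suc (toℕ j)))))
      ≡⟨ parity-telescope (suc m) colorAt w ⟩
    χ fzero xor colorAt (w ⊓ suc m)
      ≡⟨ cong (λ i → χ fzero xor colorAt i) (m≤n⇒m⊓n≡m w≤n) ⟩
    χ fzero xor colorAt w ∎
    where open ≡-Reasoning

  parity-cutEdges-before : ∀ v →
    parity (map (λ j → (toℕ j <ᵇ toℕ v) ∧ cutEdges χ j) (allFin (suc m))) ≡ χ fzero xor χ v
  parity-cutEdges-before v =
    trans (parity-cutEdges-below (toℕ v) (<⇒≤ (toℕ<n v))) (cong (χ fzero xor_) (colorAt-toℕ v))

  parity-cutEdges : parity (map (cutEdges χ) (allFin (suc m))) ≡ false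
  parity-cutEdges = begin
    parity (map (cutEdges χ) (allFin (suc m)))
      ≡⟨ cong parity (map-cong (λ j →
           cong (_∧ cutEdges χ j) (sym (to T-≡ (<⇒<ᵇ (toℕ<n j))))) (allFin (suc m))) ⟩
    parity (map (λ j → (toℕ j <ᵇ suc m) ∧ cutEdges χ j) (allFin (suc m)))
      ≡⟨ parity-cutEdges-below (suc m) ≤-refl ⟩
    χ fzero xor colorAt (suc m)
      ≡⟨ cong (χ fzero xor_) colorAt-period ⟩
    χ fzero xor χ fzero
      ≡⟨ xor-same (χ fzero) ⟩
    false ∎
    where open ≡-Reasoning

  induced-cutEdges : ∀ v → induced (cutEdges χ) v ≡ χ fzero xor χ v
  induced-cutEdges v =
    trans (parity-map-filter (λ j → toℕ j <? toℕ v) (cutEdges χ) (allFin (suc m)))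
          (parity-cutEdges-before v)

  less-cutEdges : less (cutEdges χ) ≡ minority χ
  less-cutEdges = trans (minority-cong induced-cutEdges) (minority-flip (χ fzero) χ)

positions : ∀ {n} → EdgeSet n → List ℕ
positions {n} C = map toℕ (filterᵇ C (allFin n))

parityBelow : List ℕ → ℕ → Bool
parityBelow L w = parity (map (_<ᵇ w) L)

oddLength : ∀ {A : Set} → List A → Bool
oddLength xs = parity (map (λ _ → true) xs)

module _ {n : ℕ} where

  positions-cong : ∀ {C D : EdgeSet n} → C ≗ D → positions C ≡ positions D
  positions-cong C≗D = cong (map toℕ) (filterᵇ-cong C≗D (allFin n))

  positions-sorted : ∀ (C : EdgeSet n) → AllPairs _<_ (positions C)
  positions-sorted C = AllPairs.map⁺ (AllPairs.filter⁺ (T? ∘ C) (AllPairs.tabulate⁺-< id))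

  parityBelow-positions : ∀ (C : EdgeSet n) w →
    parityBelow (positions C) w ≡ parity (map (λ j → (toℕ j <ᵇ w) ∧ C j) (allFin n))
  parityBelow-positions C w = begin
    parity (map (_<ᵇ w) (map toℕ (filterᵇ C (allFin n))))
      ≡⟨ cong parity (sym (map-∘ (filterᵇ C (allFin n)))) ⟩
    parity (map (λ j → toℕ j <ᵇ w) (filterᵇ C (allFin n)))
      ≡⟨ parity-map-filter (T? ∘ C) (λ j → toℕ j <ᵇ w) (allFin n) ⟩
    parity (map (λ j → C j ∧ (toℕ j <ᵇ w)) (allFin n))
      ≡⟨ cong parity (map-cong (λ j → ∧-comm (C j) (toℕ j <ᵇ w)) (allFin n)) ⟩
    parity (map (λ j → (toℕ j <ᵇ w) ∧ C j) (allFin n)) ∎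
    where open ≡-Reasoning

  oddLength-positions : ∀ (C : EdgeSet n) → oddLength (positions C) ≡ parity (map C (allFin n))
  oddLength-positions C = begin
    parity (map (λ _ → true) (map toℕ (filterᵇ C (allFin n))))
      ≡⟨ cong parity (sym (map-∘ (filterᵇ C (allFin n)))) ⟩
    parity (map (λ _ → true) (filterᵇ C (allFin n)))
      ≡⟨ parity-map-filter (T? ∘ C) (λ _ → true) (allFin n) ⟩
    parity (map (λ j → C j ∧ true) (allFin n))
      ≡⟨ cong parity (map-cong (∧-identityʳ ∘ C) (allFin n)) ⟩
    parity (map C (allFin n)) ∎
    where open ≡-Reasoning

parityBelow-≤ : ∀ {w} L → All (w ≤_) L → parityBelow L w ≡ false
parityBelow-≤         []      []           = refl
parityBelow-≤ {w} (a ∷ L) (w≤a ∷ w≤L) with a <ᵇ w | <ᵇ-reflects-< a w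
... | false | _       = parityBelow-≤ L w≤L
... | true  | ofʸ a<w = ⊥-elim (<⇒≱ a<w w≤a)

parityBelow-pair : ∀ {a b w} rest → a < b → All (b <_) rest →
                   T (parityBelow (a ∷ b ∷ rest) w) → (a < w × w ≤ b) ⊎ T (parityBelow rest w)
parityBelow-pair {a} {b} {w} rest a<b b<rest odd with a <ᵇ w | <ᵇ-reflects-< a w
... | false | ofⁿ a≮w =
  ⊥-elim (subst T (parityBelow-≤ (b ∷ rest) (w≤b ∷ All.map (≤-trans w≤b ∘ <⇒≤) b<rest)) odd)
  where
    w≤b : w ≤ b
    w≤b = ≤-trans (≮⇒≥ a≮w) (<⇒≤ a<b)
... | true  | ofʸ a<w with b <ᵇ w | <ᵇ-reflects-< b w
...   | false | ofⁿ b≮w = inj₁ (a<w , ≮⇒≥ b≮w)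
...   | true  | _       = inj₂ (subst T (not-involutive _) odd)

¬parityBelow-∷ : ∀ {a w} M → T (not (parityBelow (a ∷ M) w)) → w ≤ a ⊎ T (parityBelow M w)
¬parityBelow-∷ {a} {w} M even with a <ᵇ w | <ᵇ-reflects-< a w
... | false | ofⁿ a≮w = inj₁ (≮⇒≥ a≮w)
... | true  | _       = inj₂ (subst T (not-involutive _) even)

module _ {n : ℕ} where

  inArc-between : ∀ a b (v : Fin n) → a < toℕ v → toℕ v ≤ b → T (inArc a b v)
  inArc-between a b v a<v v≤b with a <ᵇ b
  ... | true  = from T-∧ (<⇒<ᵇ a<v , ≤⇒≤ᵇ v≤b)
  ... | false = from T-∨ (inj₁ (<⇒<ᵇ a<v))

  inArc-wrap : ∀ a b (v : Fin n) → b < a → a < toℕ v ⊎ toℕ v ≤ b → T (inArc a b v)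
  inArc-wrap a b v b<a outside with a <ᵇ b | <ᵇ-reflects-< a b
  ... | true  | ofʸ a<b = ⊥-elim (<-asym a<b b<a)
  ... | false | _       = from T-∨ (Sum.map <⇒<ᵇ ≤⇒≤ᵇ outside)

  count-parityBelow≤pairSizes : ∀ L → AllPairs _<_ L → oddLength L ≡ false →
                                count {n} (λ v → parityBelow L (toℕ v)) ≤ pairSizes n L
  count-parityBelow≤pairSizes []      _ _  = ≤-reflexive (count-false {n})
  count-parityBelow≤pairSizes (a ∷ []) _ ()
  count-parityBelow≤pairSizes (a ∷ b ∷ rest) ((a<b ∷ _) ∷ b<rest ∷ sorted) even = begin
    count {n} (λ v → parityBelow (a ∷ b ∷ rest) (toℕ v))
      ≤⟨ count-cover (λ v → Sum.map₁ (uncurry (inArc-between a b v)) ∘ parityBelow-pair rest a<b b<rest) ⟩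
    arcSize n a b + count {n} (λ v → parityBelow rest (toℕ v))
      ≤⟨ +-monoʳ-≤ (arcSize n a b)
           (count-parityBelow≤pairSizes rest sorted (trans (sym (not-involutive _)) even)) ⟩
    arcSize n a b + pairSizes n rest ∎
    where open ≤-Reasoning

  -- For L = a ∷ M, the nodes outside Φ₀ are those up to a and those with an odd number of M
  -- before them; Φ₁ pairs up M and closes with the wrap-around arc from the last element to a.
  count-≤ᵇ-∨-parityBelow≤pairSizes : ∀ a M → AllPairs _<_ M → All (a <_) M → oddLength M ≡ true →
    count {n} (λ v → (toℕ v ≤ᵇ a) ∨ parityBelow M (toℕ v)) ≤ pairSizes n (M ++ [ a ])
  count-≤ᵇ-∨-parityBelow≤pairSizes a [] _ _ ()
  count-≤ᵇ-∨-parityBelow≤pairSizes a (z ∷ []) _ (a<z ∷ []) _ = begin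
    count {n} (λ v → (toℕ v ≤ᵇ a) ∨ parityBelow (z ∷ []) (toℕ v))
      ≤⟨ count-mono (λ v → inArc-wrap z a v a<z ∘ outside v) ⟩
    arcSize n z a
      ≡⟨ +-identityʳ (arcSize n z a) ⟨
    arcSize n z a + 0 ∎
    where
      open ≤-Reasoning
      outside : ∀ v → T ((toℕ v ≤ᵇ a) ∨ ((z <ᵇ toℕ v) xor false)) → z < toℕ v ⊎ toℕ v ≤ a
      outside v = Sum.swap ∘ Sum.map (≤ᵇ⇒≤ _ _) (<ᵇ⇒< _ _ ∘ subst T (xor-identityʳ _)) ∘ to T-∨
  count-≤ᵇ-∨-parityBelow≤pairSizes a (b ∷ c ∷ M) ((b<c ∷ _) ∷ c<M ∷ sorted) (_ ∷ _ ∷ a<M) odd = begin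
    count {n} (λ v → (toℕ v ≤ᵇ a) ∨ parityBelow (b ∷ c ∷ M) (toℕ v))
      ≤⟨ count-cover split ⟩
    arcSize n b c + count {n} (λ v → (toℕ v ≤ᵇ a) ∨ parityBelow M (toℕ v))
      ≤⟨ +-monoʳ-≤ (arcSize n b c)
           (count-≤ᵇ-∨-parityBelow≤pairSizes a M sorted a<M (trans (sym (not-involutive _)) odd)) ⟩
    arcSize n b c + pairSizes n (M ++ [ a ]) ∎
    where
      open ≤-Reasoning
      split : ∀ v → T ((toℕ v ≤ᵇ a) ∨ parityBelow (b ∷ c ∷ M) (toℕ v)) →
              T (inArc b c v) ⊎ T ((toℕ v ≤ᵇ a) ∨ parityBelow M (toℕ v))
      split v h with to T-∨ h
      ... | inj₁ v≤a = inj₂ (from T-∨ (inj₁ v≤a))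
      ... | inj₂ odd-bc with parityBelow-pair M b<c c<M odd-bc
      ...   | inj₁ (b<v , v≤c) = inj₁ (inArc-between b c v b<v v≤c)
      ...   | inj₂ odd-M       = inj₂ (from T-∨ (inj₂ odd-M))

Φsizeᴸ : ℕ → List ℕ → ℕ
Φsizeᴸ n []      = 0
Φsizeᴸ n (a ∷ M) = pairSizes n (a ∷ M) ⊓ pairSizes n (M ++ [ a ])

Φ₁size-∷ : ∀ {n} (Copt Coff : EdgeSet n) {a M} → diffEdges Copt Coff ≡ a ∷ M →
          Φ₁size Copt Coff ≡ pairSizes n (M ++ [ a ])
Φ₁size-∷ Copt Coff eq with diffEdges Copt Coff | eq
... | _ | refl = refl

Φsize≡Φsizeᴸ : ∀ {n} (Copt Coff : EdgeSet n) → Φsize Copt Coff ≡ Φsizeᴸ n (diffEdges Copt Coff)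
Φsize≡Φsizeᴸ {n} Copt Coff with diffEdges Copt Coff in eq
... | []    = refl
... | _ ∷ _ = cong₂ _⊓_ (cong (pairSizes n) eq) (Φ₁size-∷ Copt Coff eq)

minority-parityBelow≤Φsizeᴸ : ∀ {n} L → AllPairs _<_ L → oddLength L ≡ false →
                              minority {n} (λ v → parityBelow L (toℕ v)) ≤ Φsizeᴸ n L
minority-parityBelow≤Φsizeᴸ {n} [] _ _ = ≤-trans (m⊓n≤m _ _) (≤-reflexive (count-false {n}))
minority-parityBelow≤Φsizeᴸ {n} (a ∷ M) sorted@(a<M ∷ M-sorted) even = ⊓-mono-≤
  (count-parityBelow≤pairSizes (a ∷ M) sorted even)
  (≤-trans (count-mono {n} (λ v → from T-∨ ∘ Sum.map₁ ≤⇒≤ᵇ ∘ ¬parityBelow-∷ {w = toℕ v} M))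
           (count-≤ᵇ-∨-parityBelow≤pairSizes a M M-sorted a<M
              (trans (sym (not-involutive _)) (cong not even))))

minority≤Φsizeᴸ-positions : ∀ {m} (ψ : Coloring (suc m)) →
                            minority ψ ≤ Φsizeᴸ (suc m) (positions (cutEdges ψ))
minority≤Φsizeᴸ-positions {m} ψ = begin
  minority ψ
    ≡⟨ minority-flip (ψ fzero) ψ ⟨
  minority (λ v → ψ fzero xor ψ v)
    ≡⟨ minority-cong (λ v →
         sym (trans (parityBelow-positions (cutEdges ψ) (toℕ v)) (parity-cutEdges-before ψ v))) ⟩
  minority {suc m} (λ v → parityBelow L (toℕ v))
    ≤⟨ minority-parityBelow≤Φsizeᴸ L (positions-sorted (cutEdges ψ))
         (trans (oddLength-positions (cutEdges ψ)) (parity-cutEdges ψ)) ⟩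
  Φsizeᴸ (suc m) L ∎
  where
    open ≤-Reasoning
    L = positions (cutEdges ψ)

cutEdges-⊕ : ∀ {n} (χ φ : Coloring n) → (∀ e → cutEdges φ e ≡ true → cutEdges χ e ≡ true) →
             ∀ e → cutEdges χ e ∧ not (cutEdges φ e) ≡ cutEdges (χ ⊕ φ) e
cutEdges-⊕ χ φ φ⊆χ e =
  trans (∧-not≡xor (cutEdges χ e) (cutEdges φ e) (φ⊆χ e))
        (xor-interchange (χ e) (χ (next e)) (φ e) (φ (next e)))

minority-⊕≤Φsize : ∀ {m} (χ φ : Coloring (suc m)) →
                   (∀ e → cutEdges φ e ≡ true → cutEdges χ e ≡ true) →
                   minority (χ ⊕ φ) ≤ Φsize (cutEdges χ) (cutEdges φ)
minority-⊕≤Φsize {m} χ φ φ⊆χ = begin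
  minority (χ ⊕ φ)
    ≤⟨ minority≤Φsizeᴸ-positions (χ ⊕ φ) ⟩
  Φsizeᴸ (suc m) (positions (cutEdges (χ ⊕ φ)))
    ≡⟨ cong (Φsizeᴸ (suc m)) (positions-cong (cutEdges-⊕ χ φ φ⊆χ)) ⟨
  Φsizeᴸ (suc m) (diffEdges (cutEdges χ) (cutEdges φ))
    ≡⟨ Φsize≡Φsizeᴸ (cutEdges χ) (cutEdges φ) ⟨
  Φsize (cutEdges χ) (cutEdges φ) ∎
  where open ≤-Reasoning

lemma13 : (n k : ℕ) → n ≡ 2 * k →
          (χOPT χOFF : Coloring n) →
          (∀ e → cutEdges χOFF e ≡ true → cutEdges χOPT e ≡ true) →
          count χOPT ≡ k → count (λ v → not (χOPT v)) ≡ k →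
          less (cutEdges χOFF) + Φsize (cutEdges χOPT) (cutEdges χOFF) ≥ k
lemma13 zero    _ _ _    _    _    refl _ = z≤n
lemma13 (suc m) k _ χOPT χOFF OFF⊆OPT red blue = begin
  k                                      ≡⟨ ⊓-idem k ⟨
  k ⊓ k                                  ≡⟨ cong₂ _⊓_ red blue ⟨
  minority χOPT                          ≡⟨ minority-cong (λ v → xor-cancelʳ (χOPT v) (χOFF v)) ⟨
  minority (ψ ⊕ χOFF)                    ≤⟨ minority-⊕ ψ χOFF ⟩
  minority ψ + minority χOFF             ≡⟨ +-comm (minority ψ) (minority χOFF) ⟩
  minority χOFF + minority ψ             ≤⟨ +-mono-≤ (≤-reflexive (sym (less-cutEdges χOFF)))
                                                      (minority-⊕≤Φsize χOPT χOFF OFF⊆OPT) ⟩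
  less (cutEdges χOFF) + Φsize (cutEdges χOPT) (cutEdges χOFF) ∎
  where
    open ≤-Reasoning
    ψ = χOPT ⊕ χOFF
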